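{- A simple stochastic game $G$ is a Stopping Game if and only if $G$ contains no bad subgraph.
   Context: A simple stochastic game (SSG) is a finite directed graph $G$ whose nodes are of four types: max, min, average and terminal. There are exactly two terminal nodes, terminal-0 and terminal-1, which have no out-arcs; every max, min and average node has exactly two out-arcs (the two arcs may coincide and may be self-loops). A max strategy $\sigma$ is a choice of one out-arc at each max node; a min strategy $\tau$ is a choice of one out-arc at each min node. The strategy subgraph $G_{\sigma,\tau}$ is obtained from $G$ by deleting, at each max node, the out-arc not chosen by $\sigma$ and, at each min node, the out-arc not chosen by $\tau$ (average nodes keep both arcs). $G$ is a Stopping Game if for every pair $(\sigma,\tau)$ of max/min strategies and every node $v$ there is a directed path in $G_{\sigma,\tau}$ from $v$ to a terminal node. A bad subgraph of $G$ is a nonempty set $S$ of nodes of $G$ such that: (1) every max node in $S$ has at least one out-arc with head in $S$; (2) every min node in $S$ has at least one out-arc with head in $S$; (3) every average node in $S$ has both out-arcs with heads in $S$; (4) $S$ contains no terminal node; (5) for any $u,v\in S$ there is a directed path from $u$ to $v$ in $G$ using only nodes of $S$. -}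

module Defs where

open import Data.Nat using (ℕ)
open import Data.Fin using (Fin)
open import Data.Fin.Subset using (Subset; _∈_; Nonempty)
open import Data.Bool using (Bool)
open import Data.Product using (Σ; ∃; _×_; _,_)
open import Data.Empty using (⊥)
open import Data.Unit using (⊤)
open import Relation.Binary.PropositionalEquality using (_≡_)
open import Relation.Binary.Construct.Closure.ReflexiveTransitive using (Star)

data NodeType : Set where
  maxN minN avgN term0 term1 : NodeType

-- Every non-terminal node v has exactly two out-arcs, indexed by Bool:
-- the arc (v , out v b) for b : Bool (the two arcs may coincide / be loops).
-- The value of `out` at terminal nodes is irrelevant: terminals have no
-- out-arcs (see `Arc`).
record SSG (n : ℕ) : Set where
  field
    kind   : Fin n → NodeType
    out    : Fin n → Bool → Fin n
    t0     : Fin n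
    t1     : Fin n
    t0-ok  : kind t0 ≡ term0
    t1-ok  : kind t1 ≡ term1
    t0-uniq : ∀ v → kind v ≡ term0 → v ≡ t0
    t1-uniq : ∀ v → kind v ≡ term1 → v ≡ t1

module _ {n : ℕ} (G : SSG n) where
  open SSG G

  IsTerminal : Fin n → Set
  IsTerminal v with kind v
  ... | term0 = ⊤
  ... | term1 = ⊤
  ... | _     = ⊥

  Arc : Fin n → Fin n → Set
  Arc u v with kind u
  ... | term0 = ⊥
  ... | term1 = ⊥
  ... | _     = ∃ λ (b : Bool) → out u b ≡ v

  -- A max (resp. min) strategy: a choice of out-arc (a Bool) at each node;
  -- only its values at max (resp. min) nodes matter.
  Strategy : Set
  Strategy = Fin n → Bool

  SArc : Strategy → Strategy → Fin n → Fin n → Set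
  SArc σ τ u v with kind u
  ... | maxN  = out u (σ u) ≡ v
  ... | minN  = out u (τ u) ≡ v
  ... | avgN  = ∃ λ (b : Bool) → out u b ≡ v
  ... | term0 = ⊥
  ... | term1 = ⊥

  StoppingGame : Set
  StoppingGame = ∀ (σ τ : Strategy) (v : Fin n) →
    ∃ λ t → IsTerminal t × Star (SArc σ τ) v t

  ArcIn : Subset n → Fin n → Fin n → Set
  ArcIn S u v = u ∈ S × v ∈ S × Arc u v

  BadLocal : Subset n → Fin n → Set
  BadLocal S v with kind v
  ... | maxN  = ∃ λ (b : Bool) → out v b ∈ S
  ... | minN  = ∃ λ (b : Bool) → out v b ∈ S
  ... | avgN  = ∀ (b : Bool) → out v b ∈ S
  ... | term0 = ⊥
  ... | term1 = ⊥

  BadSubgraph : Subset n → Set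
  BadSubgraph S =
    Nonempty S ×
    (∀ v → v ∈ S → BadLocal S v) ×
    (∀ u v → u ∈ S → v ∈ S → Star (ArcIn S) u v)

{-# OPTIONS --safe #-}
module Submission where

-- If S is a bad subgraph, strategies that always stay inside S confine every
-- play starting in S, so no terminal is reachable and G is not stopping.
-- Conversely, if under σ and τ no terminal is reachable from v, follow
-- G_{σ,τ} from v down to a bottom strongly connected component: it is closed
-- under the moves of G_{σ,τ}, avoids the terminals and is strongly connected,
-- hence bad.  Reachability in a finite graph is decidable, which makes this
-- direction constructive.

open import Defs
open import Level using (Level)
open import Data.Nat using (ℕ)
open import Data.Fin using (Fin; _≟_)
open import Data.Fin.Properties using (any?)
open import Data.Fin.Subset using (Subset; _∈_; _∉_; _∪_; ⁅_⁆; _⊂_; _⊃_)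
open import Data.Fin.Subset.Properties using (_∈?_; p⊆p∪q; q⊆p∪q; x∈p∪q⁻; x∈⁅x⁆; x∈⁅y⁆⇒x≡y)
open import Data.Fin.Subset.Induction using (⊂-wellFounded; ⊃-wellFounded)
open import Induction.WellFounded using (Acc; acc)
open import Data.Bool using (true; false)
open import Data.Product using (∃; ∃₂; _×_; _,_)
open import Data.Sum using (_⊎_; inj₁; inj₂)
open import Data.Empty using (⊥-elim)
open import Data.Unit using (tt)
open import Function using (_∘_)
open import Relation.Nullary using (¬_; yes; no; does)
open import Relation.Nullary.Decidable using (_×-dec_; _⊎-dec_; ¬?; map′; decidable-stable)
open import Relation.Binary using (Rel; Decidable)
open import Relation.Binary.PropositionalEquality using (_≡_; refl; sym; subst)
open import Relation.Binary.Construct.Closure.ReflexiveTransitive using (Star; ε; _◅_; _◅◅_)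

private
  variable
    ℓ : Level
    n : ℕ

Closed : Rel (Fin n) ℓ → Subset n → Set ℓ
Closed E X = ∀ {x y} → x ∈ X → E x y → y ∈ X

Star-closed : {E : Rel (Fin n) ℓ} {X : Subset n} → Closed E X →
              ∀ {x y} → x ∈ X → Star E x y → y ∈ X
Star-closed closed x∈X ε       = x∈X
Star-closed closed x∈X (e ◅ p) = Star-closed closed (closed x∈X e) p

p⊂p∪⁅x⁆ : {p : Subset n} {x : Fin n} → x ∉ p → p ⊂ p ∪ ⁅ x ⁆
p⊂p∪⁅x⁆ {p = p} {x} x∉p = p⊆p∪q ⁅ x ⁆ , x , q⊆p∪q p ⁅ x ⁆ (x∈⁅x⁆ x) , x∉p

module Reachability {n : ℕ} (E : Rel (Fin n) ℓ) (E? : Decidable E) where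

  Exit : Subset n → Set ℓ
  Exit X = ∃₂ λ x y → x ∈ X × E x y × y ∉ X

  closed-or-exit : ∀ X → Closed E X ⊎ Exit X
  closed-or-exit X with any? (λ x → any? λ y → x ∈? X ×-dec E? x y ×-dec ¬? (y ∈? X))
  ... | yes exit = inj₂ exit
  ... | no ¬exit = inj₁ λ {x} {y} x∈X e →
    decidable-stable (y ∈? X) λ y∉X → ¬exit (x , y , x∈X , e , y∉X)

  ReachedFrom : Fin n → Subset n → Set ℓ
  ReachedFrom v X = ∀ {y} → y ∈ X → Star E v y

  record ReachableSet (v : Fin n) : Set ℓ where
    field
      set     : Subset n
      source  : v ∈ set
      reached : ReachedFrom v set
      closed  : Closed E set

  reached-∪⁅⁆ : ∀ {v X x y} → ReachedFrom v X → x ∈ X → E x y → ReachedFrom v (X ∪ ⁅ y ⁆)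
  reached-∪⁅⁆ {X = X} {y = y} reached x∈X e z∈ with x∈p∪q⁻ X ⁅ y ⁆ z∈
  ... | inj₁ z∈X  = reached z∈X
  ... | inj₂ z∈⁅y⁆ with refl ← x∈⁅y⁆⇒x≡y y z∈⁅y⁆ = reached x∈X ◅◅ (e ◅ ε)

  grow : ∀ {v} X → Acc _⊃_ X → v ∈ X → ReachedFrom v X → ReachableSet v
  grow X (acc larger) v∈X reached with closed-or-exit X
  ... | inj₁ closed = record { set = X ; source = v∈X ; reached = reached ; closed = closed }
  ... | inj₂ (x , y , x∈X , e , y∉X) =
    grow (X ∪ ⁅ y ⁆) (larger (p⊂p∪⁅x⁆ y∉X)) (p⊆p∪q ⁅ y ⁆ v∈X) (reached-∪⁅⁆ reached x∈X e)

  reachable : ∀ v → ReachableSet v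
  reachable v = grow ⁅ v ⁆ (⊃-wellFounded _) (x∈⁅x⁆ v) λ y∈⁅v⁆ →
    subst (Star E v) (sym (x∈⁅y⁆⇒x≡y v y∈⁅v⁆)) ε

  Reach : Fin n → Subset n
  Reach v = ReachableSet.set (reachable v)

  Reach-sound : ∀ {v} → ReachedFrom v (Reach v)
  Reach-sound {v} = ReachableSet.reached (reachable v)

  Reach-closed : ∀ {v} → Closed E (Reach v)
  Reach-closed {v} = ReachableSet.closed (reachable v)

  Reach-complete : ∀ {v y} → Star E v y → y ∈ Reach v
  Reach-complete {v} = Star-closed Reach-closed (ReachableSet.source (reachable v))

  Star? : Decidable (Star E)
  Star? v y = map′ Reach-sound Reach-complete (y ∈? Reach v)

  InBottomComponent : Fin n → Set ℓ
  InBottomComponent w = ∀ {z} → Star E w z → Star E z w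

  Reach-⊂ : ∀ {u z} → Star E u z → ¬ Star E z u → Reach z ⊂ Reach u
  Reach-⊂ {u} u↝z z↛u =
    (λ y∈ → Reach-complete (u↝z ◅◅ Reach-sound y∈)) , u , Reach-complete ε , z↛u ∘ Reach-sound

  descend : ∀ u → Acc _⊂_ (Reach u) → ∃ λ w → Star E u w × InBottomComponent w
  descend u (acc smaller) with any? (λ z → Star? u z ×-dec ¬? (Star? z u))
  ... | yes (z , u↝z , z↛u) =
    let (w , z↝w , bottom) = descend z (smaller (Reach-⊂ u↝z z↛u)) in w , u↝z ◅◅ z↝w , bottom
  ... | no ¬escape = u , ε , λ {z} u↝z → decidable-stable (Star? z u) λ z↛u → ¬escape (z , u↝z , z↛u)

  reaches-bottom-component : ∀ v → ∃ λ w → Star E v w × InBottomComponent w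
  reaches-bottom-component v = descend v (⊂-wellFounded _)

module _ {n : ℕ} (G : SSG n) where
  open SSG G

  SArc? : ∀ σ τ → Decidable (SArc G σ τ)
  SArc? σ τ u v with kind u
  ... | maxN  = out u (σ u) ≟ v
  ... | minN  = out u (τ u) ≟ v
  ... | avgN  = map′ (λ where (inj₁ e) → true , e ; (inj₂ e) → false , e)
                     (λ where (true , e) → inj₁ e ; (false , e) → inj₂ e)
                     (out u true ≟ v ⊎-dec out u false ≟ v)
  ... | term0 = no λ ()
  ... | term1 = no λ ()

  module Play (σ τ : Strategy G) = Reachability (SArc G σ τ) (SArc? σ τ)

  SArc⇒Arc : ∀ {σ τ u v} → SArc G σ τ u v → Arc G u v
  SArc⇒Arc {σ} {τ} {u} e with kind u
  ... | maxN = σ u , e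
  ... | minN = τ u , e
  ... | avgN = e

  terminal-¬BadLocal : ∀ {S t} → IsTerminal G t → ¬ BadLocal G S t
  terminal-¬BadLocal {t = t} terminal local with kind t
  ... | term0 = local
  ... | term1 = local

  towards : Subset n → Strategy G
  towards S v = does (out v true ∈? S)

  towards-∈ : ∀ {S v} → ∃ (λ b → out v b ∈ S) → out v (towards S v) ∈ S
  towards-∈ {S} {v} (b , out∈S) with out v true ∈? S | b
  ... | yes true∈S | _     = true∈S
  ... | no true∉S  | true  = ⊥-elim (true∉S out∈S)
  ... | no _       | false = out∈S

  towards-stays : ∀ {S x y} → BadLocal G S x → SArc G (towards S) (towards S) x y → y ∈ S
  towards-stays {S} {x} local e with kind x
  ... | maxN  = subst (_∈ S) e (towards-∈ local)
  ... | minN  = subst (_∈ S) e (towards-∈ local)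
  ... | avgN  = let (b , out≡y) = e in subst (_∈ S) out≡y (local b)
  ... | term0 = ⊥-elim local
  ... | term1 = ⊥-elim local

  stopping⇒no-bad : StoppingGame G → ¬ ∃ (BadSubgraph G)
  stopping⇒no-bad stopping (S , (v , v∈S) , local , _) =
    let (t , terminal , v↝t) = stopping (towards S) (towards S) v
        t∈S = Star-closed (λ {x} x∈S → towards-stays (local x x∈S)) v∈S v↝t
    in terminal-¬BadLocal terminal (local t t∈S)

  t0-terminal : IsTerminal G t0
  t0-terminal rewrite t0-ok = tt

  t1-terminal : IsTerminal G t1
  t1-terminal rewrite t1-ok = tt

  terminal-cases : ∀ {t} → IsTerminal G t → t ≡ t0 ⊎ t ≡ t1
  terminal-cases {t} terminal with kind t in eq
  ... | term0 = inj₁ (t0-uniq t eq)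
  ... | term1 = inj₂ (t1-uniq t eq)

  moves-stay⇒BadLocal : ∀ {σ τ S x} → (∀ {y} → SArc G σ τ x y → y ∈ S) →
                        ¬ IsTerminal G x → BadLocal G S x
  moves-stay⇒BadLocal {σ} {τ} {x = x} stays nonterminal with kind x
  ... | maxN  = σ x , stays refl
  ... | minN  = τ x , stays refl
  ... | avgN  = λ b → stays (b , refl)
  ... | term0 = nonterminal tt
  ... | term1 = nonterminal tt

  Star-ArcIn : ∀ {σ τ S x y} → Closed (SArc G σ τ) S → x ∈ S →
               Star (SArc G σ τ) x y → Star (ArcIn G S) x y
  Star-ArcIn closed x∈S ε       = ε
  Star-ArcIn closed x∈S (e ◅ p) =
    (x∈S , closed x∈S e , SArc⇒Arc e) ◅ Star-ArcIn closed (closed x∈S e) p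

  module _ {σ τ : Strategy G} where
    open Play σ τ

    bottom-component-bad : ∀ {w} → InBottomComponent w →
                           (∀ {t} → Star (SArc G σ τ) w t → ¬ IsTerminal G t) →
                           BadSubgraph G (Reach w)
    bottom-component-bad {w} bottom avoids = (w , Reach-complete ε) , local , connected
      where
        local : ∀ x → x ∈ Reach w → BadLocal G (Reach w) x
        local x x∈ = moves-stay⇒BadLocal (Reach-closed x∈) (avoids (Reach-sound x∈))

        connected : ∀ x y → x ∈ Reach w → y ∈ Reach w → Star (ArcIn G (Reach w)) x y
        connected x y x∈ y∈ = Star-ArcIn Reach-closed x∈ (bottom (Reach-sound x∈) ◅◅ Reach-sound y∈)

    avoids-terminals : ∀ {v t} → ¬ Star (SArc G σ τ) v t0 → ¬ Star (SArc G σ τ) v t1 →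
                       Star (SArc G σ τ) v t → ¬ IsTerminal G t
    avoids-terminals v↛t0 v↛t1 v↝t terminal with terminal-cases terminal
    ... | inj₁ refl = v↛t0 v↝t
    ... | inj₂ refl = v↛t1 v↝t

    trapped⇒bad : ∀ {v} → ¬ Star (SArc G σ τ) v t0 → ¬ Star (SArc G σ τ) v t1 → ∃ (BadSubgraph G)
    trapped⇒bad {v} v↛t0 v↛t1 =
      let (w , v↝w , bottom) = reaches-bottom-component v
      in Reach w , bottom-component-bad bottom (avoids-terminals v↛t0 v↛t1 ∘ (v↝w ◅◅_))

  no-bad⇒stopping : ¬ ∃ (BadSubgraph G) → StoppingGame G
  no-bad⇒stopping no-bad σ τ v with Play.Star? σ τ v t0 | Play.Star? σ τ v t1
  ... | yes v↝t0 | _        = t0 , t0-terminal , v↝t0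
  ... | no _     | yes v↝t1 = t1 , t1-terminal , v↝t1
  ... | no v↛t0  | no v↛t1  = ⊥-elim (no-bad (trapped⇒bad v↛t0 v↛t1))

lemma2 : ∀ {n : ℕ} (G : SSG n) →
    (StoppingGame G → ¬ (∃ λ (S : Subset n) → BadSubgraph G S)) ×
    (¬ (∃ λ (S : Subset n) → BadSubgraph G S) → StoppingGame G)
lemma2 G = stopping⇒no-bad G , no-bad⇒stopping G
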